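{- The class of $(P_1+\overline{P_1+P_3})$-free split graphs has bounded clique-width.
   Context: All graphs are finite, simple and undirected. $G$ is $H$-free if it has no induced subgraph isomorphic to $H$. A split graph is a graph whose vertex set can be partitioned into a clique and an independent set (either possibly empty). $P_r$ is the path on $r$ vertices, $+$ denotes disjoint union and $\overline{G}$ the complement; $\overline{P_1+P_3}$ is the paw (a triangle with one pendant vertex). The clique-width of a graph $G$ is the minimum number $k$ of labels needed to construct $G$ using the operations: create a single vertex with label $i$; take the disjoint union of two labelled graphs; add all edges between vertices of label $i$ and vertices of label $j$ ($i\neq j$); rename label $i$ to $j$. A class of graphs has bounded clique-width if there is a constant $c$ such that every graph in the class has clique-width at most $c$. -}

module Defs where

open import Data.Nat using (ℕ; zero; suc; _+_)
open import Data.Fin using (Fin; zero; suc; splitAt; _≟_)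
open import Data.Bool using (Bool; true; false; _∧_; _∨_)
open import Data.Sum using (_⊎_; inj₁; inj₂)
open import Data.Product using (Σ; ∃; ∃-syntax; _×_; _,_)
open import Relation.Nullary using (¬_)
open import Relation.Nullary.Decidable using (⌊_⌋)
open import Relation.Binary.PropositionalEquality using (_≡_; _≢_; refl)
open import Function.Definitions using (Injective)
open import Function.Bundles using (_⤖_; Bijection)

record Graph : Set where
  field
    n      : ℕ
    adj    : Fin n → Fin n → Bool
    sym    : ∀ i j → adj i j ≡ adj j i
    irrefl : ∀ i → adj i i ≡ false
open Graph public

InducedSubgraph : Graph → Graph → Set
InducedSubgraph H G =
  Σ (Fin (n H) → Fin (n G)) λ f →
    Injective _≡_ _≡_ f × (∀ i j → adj H i j ≡ adj G (f i) (f j))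

Free : Graph → Graph → Set
Free H G = ¬ InducedSubgraph H G

-- Split graph: V = K ⊎ I with K a clique and I an independent set
-- (part v ≡ true means v ∈ K).
IsSplit : Graph → Set
IsSplit G = Σ (Fin (n G) → Bool) λ part →
  (∀ i j → i ≢ j → part i ≡ true → part j ≡ true → adj G i j ≡ true) ×
  (∀ i j → part i ≡ false → part j ≡ false → adj G i j ≡ false)

-- P₁ + paw on Fin 5: vertex 0 isolated; 1,2,3 a triangle; 4 pendant at 3.
p1pawAdj : Fin 5 → Fin 5 → Bool
p1pawAdj (suc zero) (suc (suc zero)) = true
p1pawAdj (suc (suc zero)) (suc zero) = true
p1pawAdj (suc zero) (suc (suc (suc zero))) = true
p1pawAdj (suc (suc (suc zero))) (suc zero) = true
p1pawAdj (suc (suc zero)) (suc (suc (suc zero))) = true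
p1pawAdj (suc (suc (suc zero))) (suc (suc zero)) = true
p1pawAdj (suc (suc (suc zero))) (suc (suc (suc (suc zero)))) = true
p1pawAdj (suc (suc (suc (suc zero)))) (suc (suc (suc zero))) = true
p1pawAdj _ _ = false

private
  allFin5 : (P : Fin 5 → Set) → P zero → P (suc zero) → P (suc (suc zero))
          → P (suc (suc (suc zero))) → P (suc (suc (suc (suc zero)))) → ∀ i → P i
  allFin5 P a b c d e zero = a
  allFin5 P a b c d e (suc zero) = b
  allFin5 P a b c d e (suc (suc zero)) = c
  allFin5 P a b c d e (suc (suc (suc zero))) = d
  allFin5 P a b c d e (suc (suc (suc (suc zero)))) = e

  p1pawSym : ∀ i j → p1pawAdj i j ≡ p1pawAdj j i
  p1pawSym = allFin5 _ (allFin5 _ refl refl refl refl refl)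
                       (allFin5 _ refl refl refl refl refl)
                       (allFin5 _ refl refl refl refl refl)
                       (allFin5 _ refl refl refl refl refl)
                       (allFin5 _ refl refl refl refl refl)

  p1pawIrr : ∀ i → p1pawAdj i i ≡ false
  p1pawIrr = allFin5 _ refl refl refl refl refl

P₁+paw : Graph
P₁+paw = record { n = 5 ; adj = p1pawAdj ; sym = p1pawSym ; irrefl = p1pawIrr }

-- Clique-width expressions with labels in Fin k, indexed by number of vertices.
-- (The empty expression is included so that the null graph is covered.)
data CWExpr (k : ℕ) : ℕ → Set where
  empty  : CWExpr k 0
  vertex : Fin k → CWExpr k 1
  union  : ∀ {m l} → CWExpr k m → CWExpr k l → CWExpr k (m + l)
  join   : ∀ {m} (i j : Fin k) → i ≢ j → CWExpr k m → CWExpr k m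
  rename : ∀ {m} (i j : Fin k) → CWExpr k m → CWExpr k m

_==_ : ∀ {k} → Fin k → Fin k → Bool
i == j = ⌊ i ≟ j ⌋

label : ∀ {k m} → CWExpr k m → Fin m → Fin k
label (vertex c) _ = c
label (union {m} e f) x with splitAt m x
... | inj₁ y = label e y
... | inj₂ y = label f y
label (join i j _ e) x = label e x
label (rename i j e) x with label e x == i
... | true  = j
... | false = label e x

edge : ∀ {k m} → CWExpr k m → Fin m → Fin m → Bool
edge (vertex c) _ _ = false
edge (union {m} e f) x y with splitAt m x | splitAt m y
... | inj₁ a | inj₁ b = edge e a b
... | inj₂ a | inj₂ b = edge f a b
... | inj₁ _ | inj₂ _ = false
... | inj₂ _ | inj₁ _ = false
edge (join i j _ e) x y =
  edge e x y ∨ ((label e x == i) ∧ (label e y == j))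
             ∨ ((label e x == j) ∧ (label e y == i))
edge (rename i j e) x y = edge e x y

CWAtMost : ℕ → Graph → Set
CWAtMost k G = Σ (CWExpr k (n G)) λ e →
  Σ (Fin (n G) ⤖ Fin (n G)) λ π →
    ∀ x y → adj G x y ≡ edge e (Bijection.to π x) (Bijection.to π y)

BoundedCW : (Graph → Set) → Set
BoundedCW C = ∃[ c ] (∀ G → C G → CWAtMost c G)

module Submission where

-- If the vertices of G can be
--     inserted in the order of a key so that at every time the inserted vertices carry
--     labels from an alphabet Λ of size L, the labels evolve by maps independent of the
--     vertex, and each new vertex is adjacent to exactly some label classes, then G has
--     clique-width at most 2L + 1: one extra label for the new vertex, and a buffer copy
--     of Λ so that any map of labels can be performed by renames.
-- (2) In a (P₁ + paw)-free split graph K ⊎ I two configurations are excluded: a triangle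
--     with a pendant vertex in I and an isolated vertex in I, the triangle lying in K
--     (clique-triangle) or meeting I (split-triangle).
-- (3) Petal structures (Petals, petals⇒cw).  Split I into A and B and fix at most two
--     special vertices.  If the non-neighbourhoods in K of A-vertices are pairwise equal
--     or disjoint (petals), every B-vertex misses all petals and all B-vertices miss the
--     same clique vertices, then processing the petals one after another gives a linear
--     scheme with 6 labels.
-- (4) By (2), every such graph carries a petal structure (SplitPawFree), by a case
--     distinction on the existence of a "discord" and of a "straggler".

open import Defs hiding (sym)
open import Data.Bool using (Bool; true; false; not; _∧_; _∨_; if_then_else_)
open import Data.Bool.ListAction using (any)
open import Data.Bool.Properties using (∨-identityʳ; ∨-assoc; ∨-zeroʳ; ∧-zeroʳ)
import Data.Bool.Properties as Bool
open import Data.Empty using (⊥; ⊥-elim)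
open import Data.Fin using (Fin; zero; suc; toℕ; _≟_; _↑ˡ_; _↑ʳ_; splitAt)
open import Data.Fin.Properties
  using (all?; any?; toℕ<n; toℕ-injective; ↑ˡ-injective; ↑ʳ-injective; splitAt-↑ˡ; splitAt-↑ʳ; suc-injective)
open import Data.List using (List; []; _∷_; map; allFin; length; lookup)
open import Data.List.Membership.Propositional using (_∈_)
open import Data.List.Membership.Propositional.Properties using (∈-allFin; ∈-lookup)
open import Data.List.Properties using (length-tabulate)
open import Data.List.Relation.Binary.Permutation.Propositional using (_↭_; ↭-sym; ↭⇒↭ₛ)
open import Data.List.Relation.Binary.Permutation.Propositional.Properties using (↭-length; ∈-resp-↭)
open import Data.List.Relation.Unary.All as All using (All; []; _∷_)
open import Data.List.Relation.Unary.AllPairs using (AllPairs; []; _∷_)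
open import Data.List.Relation.Unary.Any using (index; here; there)
open import Data.List.Relation.Unary.Any.Properties using (lookup-index)
open import Data.List.Relation.Unary.Sorted.TotalOrder.Properties using (Sorted⇒AllPairs)
open import Data.List.Relation.Unary.Unique.Propositional using (Unique)
open import Data.List.Relation.Unary.Unique.Propositional.Properties using (allFin⁺)
import Data.List.Sort
open import Data.Maybe using (Maybe; just; nothing)
import Data.Maybe as Maybe
open import Data.Maybe.Properties using (just-injective)
open import Data.Nat using (ℕ; zero; suc; _+_; _≤_; _<_; z≤n; s≤s; _≤?_)
open import Data.Nat.Properties
  using (≤-refl; ≤-trans; ≤-antisym; ≤-pred; <-≤-trans; <⇒≱; ≰⇒>; n<1+n; n≤1+n; m≤n⇒m≤1+n; m≤n+m; ≤-decTotalOrder)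
open import Data.Product using (∃; _×_; _,_; proj₁; proj₂)
open import Data.Sum using (_⊎_; inj₁; inj₂; [_,_]′)
open import Function using (_∘_)
open import Function.Bundles using (mk↔ₛ′)
open import Function.Construct.Identity using (⤖-id)
open import Function.Definitions using (Injective)
open import Function.Properties.Inverse using (↔⇒⤖)
open import Relation.Binary.Bundles using (DecTotalOrder)
import Relation.Binary.Construct.Flip.EqAndOrd as Flip
import Relation.Binary.Construct.On as On
open import Relation.Binary.PropositionalEquality
open import Relation.Binary.PropositionalEquality.Properties using (subst-subst-sym; subst-sym-subst)
open import Relation.Nullary using (¬_; Dec; yes; no; ¬?; contradiction)
open import Relation.Nullary.Decidable using (does; dec-true; dec-false; from-yes; _×-dec_; _⊎-dec_)
open import Relation.Unary using (Decidable)

==-refl : ∀ {k} (i : Fin k) → (i == i) ≡ true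
==-refl i with i ≟ i
... | yes _ = refl
... | no i≢i = contradiction refl i≢i

==-≢ : ∀ {k} {i j : Fin k} → i ≢ j → (i == j) ≡ false
==-≢ {i = i} {j} i≢j with i ≟ j
... | yes i≡j = contradiction i≡j i≢j
... | no _ = refl

any-none : ∀ {A : Set} (p : A → Bool) xs → (∀ a → p a ≡ false) → any p xs ≡ false
any-none p [] none = refl
any-none p (a ∷ xs) none rewrite none a = any-none p xs none

any-some : ∀ {A : Set} (p : A → Bool) {xs a} → a ∈ xs → p a ≡ true → any p xs ≡ true
any-some p (here refl) pa rewrite pa = refl
any-some p {b ∷ _} (there a∈xs) pa rewrite any-some p a∈xs pa = ∨-zeroʳ (p b)

substitute : ∀ {k} → Fin k × Fin k → Fin k → Fin k
substitute (i , j) a = if a == i then j else a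

label-rename : ∀ {k m} i j (e : CWExpr k m) x → label (rename i j e) x ≡ substitute (i , j) (label e x)
label-rename i j e x with label e x == i
... | true = refl
... | false = refl

substitute-hit : ∀ {k} (i j : Fin k) → substitute (i , j) i ≡ j
substitute-hit i j rewrite ==-refl i = refl

substitute-miss : ∀ {k} {i j a : Fin k} → a ≢ i → substitute (i , j) a ≡ a
substitute-miss a≢i rewrite ==-≢ a≢i = refl

renameAll : ∀ {k m} → List (Fin k × Fin k) → CWExpr k m → CWExpr k m
renameAll [] e = e
renameAll ((i , j) ∷ rs) e = renameAll rs (rename i j e)

substituteAll : ∀ {k} → List (Fin k × Fin k) → Fin k → Fin k
substituteAll [] a = a
substituteAll (r ∷ rs) a = substituteAll rs (substitute r a)

label-renameAll : ∀ {k m} rs (e : CWExpr k m) x → label (renameAll rs e) x ≡ substituteAll rs (label e x)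
label-renameAll [] e x = refl
label-renameAll ((i , j) ∷ rs) e x =
  trans (label-renameAll rs (rename i j e) x) (cong (substituteAll rs) (label-rename i j e x))

edge-renameAll : ∀ {k m} rs (e : CWExpr k m) x y → edge (renameAll rs e) x y ≡ edge e x y
edge-renameAll [] e x y = refl
edge-renameAll ((i , j) ∷ rs) e x y = edge-renameAll rs (rename i j e) x y

-- Moving a family of labels s i to targets t i one by one is harmless when s is
-- injective and no target is a source: each s i ends at t i, other labels stay.
module Transfer {k L : ℕ} (s t : Fin L → Fin k)
  (s-injective : ∀ {i j} → s i ≡ s j → i ≡ j) (t≢s : ∀ i j → t i ≢ s j) where

  transfers : List (Fin L) → List (Fin k × Fin k)
  transfers = map (λ i → s i , t i)

  transfer-miss : ∀ cs a → (∀ i → a ≢ s i) → substituteAll (transfers cs) a ≡ a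
  transfer-miss [] a a∉s = refl
  transfer-miss (c ∷ cs) a a∉s rewrite substitute-miss {j = t c} (a∉s c) = transfer-miss cs a a∉s

  transfer-hit : ∀ cs i → i ∈ cs → substituteAll (transfers cs) (s i) ≡ t i
  transfer-hit (c ∷ cs) i _ with i ≟ c
  ... | yes refl rewrite substitute-hit (s i) (t i) = transfer-miss cs (t i) (t≢s i)
  transfer-hit (c ∷ cs) i (here i≡c) | no i≢c = contradiction i≡c i≢c
  transfer-hit (c ∷ cs) i (there i∈cs) | no i≢c
    rewrite substitute-miss {j = t c} (λ si≡sc → i≢c (s-injective si≡sc)) = transfer-hit cs i i∈cs

-- Expressions built below use 1 + 2L labels: one label `fresh` for the vertex
-- being inserted, a copy `old c` of every scheme label c, and a buffer copy `buf c`.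
module Alphabet (L : ℕ) where

  width : ℕ
  width = suc (L + L)

  fresh : Fin width
  fresh = zero

  old buf : Fin L → Fin width
  old c = suc (c ↑ˡ L)
  buf c = suc (L ↑ʳ c)

  old-injective : ∀ {c d} → old c ≡ old d → c ≡ d
  old-injective {c} {d} eq = ↑ˡ-injective L c d (suc-injective eq)

  buf-injective : ∀ {c d} → buf c ≡ buf d → c ≡ d
  buf-injective {c} {d} eq = ↑ʳ-injective L c d (suc-injective eq)

  old≢buf : ∀ {c d} → old c ≢ buf d
  old≢buf {c} {d} eq with trans (sym (splitAt-↑ˡ L c L)) (trans (cong (splitAt L) (suc-injective eq)) (splitAt-↑ʳ L L d))
  ... | ()

  fresh≢old : ∀ {c} → fresh ≢ old c
  fresh≢old ()

  -- An arbitrary map f on scheme labels is realised by renames: first every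
  -- old c moves to buf (f c), then every buf d moves back to old d.
  module Forth (f : Fin L → Fin L) = Transfer old (buf ∘ f) old-injective (λ _ _ eq → old≢buf (sym eq))
  module Back = Transfer buf old buf-injective (λ _ _ → old≢buf)

  forth : (Fin L → Fin L) → List (Fin width × Fin width)
  forth f = Forth.transfers f (allFin L)

  back : List (Fin width × Fin width)
  back = Back.transfers (allFin L)

  relabel : ∀ {m} → (Fin L → Fin L) → CWExpr width m → CWExpr width m
  relabel f e = renameAll back (renameAll (forth f) e)

  label-relabel : ∀ {m} f (e : CWExpr width m) x c → label e x ≡ old c → label (relabel f e) x ≡ old (f c)
  label-relabel f e x c lx = begin
    label (relabel f e) x                                   ≡⟨ label-renameAll back _ x ⟩
    substituteAll back (label (renameAll (forth f) e) x)    ≡⟨ cong (substituteAll back) (label-renameAll (forth f) e x) ⟩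
    substituteAll back (substituteAll (forth f) (label e x)) ≡⟨ cong (substituteAll back ∘ substituteAll (forth f)) lx ⟩
    substituteAll back (substituteAll (forth f) (old c))    ≡⟨ cong (substituteAll back) (Forth.transfer-hit f (allFin L) c (∈-allFin c)) ⟩
    substituteAll back (buf (f c))                          ≡⟨ Back.transfer-hit (allFin L) (f c) (∈-allFin (f c)) ⟩
    old (f c)                                               ∎
    where open ≡-Reasoning

  edge-relabel : ∀ {m} f (e : CWExpr width m) x y → edge (relabel f e) x y ≡ edge e x y
  edge-relabel f e x y = trans (edge-renameAll back _ x y) (edge-renameAll (forth f) e x y)

  joinWhen : ∀ {m} → Bool → Fin L → CWExpr width m → CWExpr width m
  joinWhen true c e = join fresh (old c) fresh≢old e
  joinWhen false c e = e

  joinAll : ∀ {m} → (Fin L → Bool) → List (Fin L) → CWExpr width m → CWExpr width m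
  joinAll β [] e = e
  joinAll β (c ∷ cs) e = joinAll β cs (joinWhen (β c) c e)

  links : Fin L → Fin width → Fin width → Bool
  links c a b = ((a == fresh) ∧ (b == old c)) ∨ ((a == old c) ∧ (b == fresh))

  label-joinWhen : ∀ {m} b c (e : CWExpr width m) x → label (joinWhen b c e) x ≡ label e x
  label-joinWhen true c e x = refl
  label-joinWhen false c e x = refl

  label-joinAll : ∀ {m} β cs (e : CWExpr width m) x → label (joinAll β cs e) x ≡ label e x
  label-joinAll β [] e x = refl
  label-joinAll β (c ∷ cs) e x = trans (label-joinAll β cs (joinWhen (β c) c e) x) (label-joinWhen (β c) c e x)

  edge-joinWhen : ∀ {m} b c (e : CWExpr width m) x y →
    edge (joinWhen b c e) x y ≡ edge e x y ∨ (b ∧ links c (label e x) (label e y))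
  edge-joinWhen true c e x y = refl
  edge-joinWhen false c e x y = sym (∨-identityʳ _)

  edge-joinAll : ∀ {m} β cs (e : CWExpr width m) x y →
    edge (joinAll β cs e) x y ≡ edge e x y ∨ any (λ c → β c ∧ links c (label e x) (label e y)) cs
  edge-joinAll β [] e x y = sym (∨-identityʳ _)
  edge-joinAll β (c ∷ cs) e x y = begin
    edge (joinAll β cs e′) x y
      ≡⟨ edge-joinAll β cs e′ x y ⟩
    edge e′ x y ∨ any (λ d → β d ∧ links d (label e′ x) (label e′ y)) cs
      ≡⟨ cong₂ (λ a b → edge e′ x y ∨ any (λ d → β d ∧ links d a b) cs) (label-joinWhen (β c) c e x) (label-joinWhen (β c) c e y) ⟩
    edge e′ x y ∨ any (λ d → β d ∧ links d (label e x) (label e y)) cs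
      ≡⟨ cong (_∨ any (λ d → β d ∧ links d (label e x) (label e y)) cs) (edge-joinWhen (β c) c e x y) ⟩
    (edge e x y ∨ (β c ∧ links c (label e x) (label e y))) ∨ any (λ d → β d ∧ links d (label e x) (label e y)) cs
      ≡⟨ ∨-assoc (edge e x y) _ _ ⟩
    edge e x y ∨ any (λ d → β d ∧ links d (label e x) (label e y)) (c ∷ cs) ∎
    where
    open ≡-Reasoning
    e′ = joinWhen (β c) c e

  any-single : ∀ (β ℓ : Fin L → Bool) d → ℓ d ≡ true → (∀ c → c ≢ d → ℓ c ≡ false) →
               any (λ c → β c ∧ ℓ c) (allFin L) ≡ β d
  any-single β ℓ d ℓd ℓc with β d in βd
  ... | true = any-some (λ c → β c ∧ ℓ c) (∈-allFin d) (cong₂ _∧_ βd ℓd)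
  ... | false = any-none (λ c → β c ∧ ℓ c) (allFin L) none
    where
    none : ∀ c → (β c ∧ ℓ c) ≡ false
    none c with c ≟ d
    ... | yes refl rewrite βd = refl
    ... | no c≢d rewrite ℓc c c≢d = ∧-zeroʳ (β c)

  old-== : ∀ {c d} → c ≢ d → (old c == old d) ≡ false
  old-== c≢d = ==-≢ (λ eq → c≢d (old-injective eq))

  old≢fresh : ∀ {c} → old c ≢ fresh
  old≢fresh ()

  no-links : ∀ (β : Fin L → Bool) a b → (∀ c → links c a b ≡ false) →
             any (λ c → β c ∧ links c a b) (allFin L) ≡ false
  no-links β a b none = any-none _ (allFin L) (λ c → trans (cong (β c ∧_) (none c)) (∧-zeroʳ (β c)))

  links-old-old : ∀ c a b → links c (old a) (old b) ≡ false
  links-old-old c a b rewrite ==-≢ (old≢fresh {a}) | ==-≢ (old≢fresh {b}) = ∧-zeroʳ _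

  links-fresh-fresh : ∀ c → links c fresh fresh ≡ false
  links-fresh-fresh c rewrite ==-≢ (fresh≢old {c}) = ∨-identityʳ _

  links-fresh-old : ∀ β d → any (λ c → β c ∧ links c fresh (old d)) (allFin L) ≡ β d
  links-fresh-old β d = any-single β (λ c → links c fresh (old d)) d hit miss
    where
    hit : links d fresh (old d) ≡ true
    hit rewrite ==-refl fresh | ==-refl (old d) = refl
    miss : ∀ c → c ≢ d → links c fresh (old d) ≡ false
    miss c c≢d rewrite ==-refl fresh | old-== (λ eq → c≢d (sym eq)) | ==-≢ (fresh≢old {c}) = refl

  links-old-fresh : ∀ β d → any (λ c → β c ∧ links c (old d) fresh) (allFin L) ≡ β d
  links-old-fresh β d = any-single β (λ c → links c (old d) fresh) d hit miss
    where
    hit : links d (old d) fresh ≡ true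
    hit rewrite ==-≢ (old≢fresh {d}) | ==-refl fresh | ==-refl (old d) = refl
    miss : ∀ c → c ≢ d → links c (old d) fresh ≡ false
    miss c c≢d rewrite ==-≢ (old≢fresh {d}) | old-== (λ eq → c≢d (sym eq)) = refl

lookup-injective : ∀ {A : Set} {xs : List A} → Unique xs → ∀ {i j} → lookup xs i ≡ lookup xs j → i ≡ j
lookup-injective {xs = x ∷ xs} (x∉xs ∷ _) {zero} {zero} _ = refl
lookup-injective {xs = x ∷ xs} (x∉xs ∷ _) {zero} {suc j} eq = contradiction eq (All.lookup x∉xs (∈-lookup j))
lookup-injective {xs = x ∷ xs} (x∉xs ∷ _) {suc i} {zero} eq = contradiction (sym eq) (All.lookup x∉xs (∈-lookup i))
lookup-injective {xs = x ∷ xs} (_ ∷ unique) {suc i} {suc j} eq = cong suc (lookup-injective unique eq)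

edge-subst : ∀ {k m m′} (p : m ≡ m′) (e : CWExpr k m) x y →
             edge (subst (CWExpr k) p e) (subst Fin p x) (subst Fin p y) ≡ edge e x y
edge-subst refl e x y = refl

enumeration-unique : ∀ {n} (ws : List (Fin n)) → ws ↭ allFin n → Unique ws
enumeration-unique {n} ws ws↭ = Unique-resp-↭ (↭⇒↭ₛ (↭-sym ws↭)) (allFin⁺ n)
  where open import Data.List.Relation.Binary.Permutation.Setoid.Properties (setoid (Fin n)) using (Unique-resp-↭)

enumeration⇒cw : ∀ {k} (G : Graph) (ws : List (Fin (n G))) → ws ↭ allFin (n G) → (e : CWExpr k (length ws)) →
                 (∀ x y → edge e x y ≡ adj G (lookup ws x) (lookup ws y)) → CWAtMost k G
enumeration⇒cw {k} G ws ws↭ e edges = subst (CWExpr k) size e , ↔⇒⤖ (mk↔ₛ′ to from to-from from-to) , edges′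
  where
  size : length ws ≡ n G
  size = trans (↭-length ws↭) (length-tabulate (λ v → v))

  unique : Unique ws
  unique = enumeration-unique ws ws↭

  position : Fin (n G) → Fin (length ws)
  position v = index (∈-resp-↭ (↭-sym ws↭) (∈-allFin v))

  lookup-position : ∀ v → lookup ws (position v) ≡ v
  lookup-position v = sym (lookup-index (∈-resp-↭ (↭-sym ws↭) (∈-allFin v)))

  to from : Fin (n G) → Fin (n G)
  to v = subst Fin size (position v)
  from y = lookup ws (subst Fin (sym size) y)

  to-from : ∀ y → to (from y) ≡ y
  to-from y = trans (cong (subst Fin size) (lookup-injective unique (lookup-position (from y)))) (subst-subst-sym size)

  from-to : ∀ v → from (to v) ≡ v
  from-to v = trans (cong (lookup ws) (subst-sym-subst size)) (lookup-position v)

  edges′ : ∀ x y → adj G x y ≡ edge (subst (CWExpr k) size e) (to x) (to y)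
  edges′ x y = sym (trans (edge-subst size e (position x) (position y))
                   (trans (edges (position x) (position y)) (cong₂ (adj G) (lookup-position x) (lookup-position y))))

record Coding (Λ : Set) (L : ℕ) : Set where
  field
    encode : Λ → Fin L
    decode : Fin L → Λ
    decode-encode : ∀ c → decode (encode c) ≡ c

-- A linear scheme: vertices are inserted in order of their keys; at time t every
-- inserted vertex u carries the label `labelAt t u`, and labels evolve between two
-- times by a map `advance` that does not depend on the vertex.  A new vertex w is
-- joined to the label classes selected by `joinsTo w`, which must reproduce exactly
-- its adjacencies to the vertices inserted before it.
record LinearScheme (G : Graph) (Λ : Set) : Set where
  field
    key : Fin (n G) → ℕ
    labelAt : ℕ → Fin (n G) → Λ
    advance : ℕ → ℕ → Λ → Λ
    joinsTo : Fin (n G) → Λ → Bool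
    adj-labelAt : ∀ u w → u ≢ w → key u ≤ key w → adj G u w ≡ joinsTo w (labelAt (key w) u)
    labelAt-advance : ∀ u t t′ → key u ≤ t → t ≤ t′ → labelAt t′ u ≡ advance t t′ (labelAt t u)

module Construction {G : Graph} {Λ : Set} {L : ℕ} (coding : Coding Λ L) (S : LinearScheme G Λ) where
  open Alphabet L
  open Coding coding
  open LinearScheme S

  V : Set
  V = Fin (n G)

  insert : ∀ {m} → V → CWExpr width m → CWExpr width (suc m)
  insert w e = rename fresh (old (encode (labelAt (key w) w)))
                 (joinAll (joinsTo w ∘ decode) (allFin L) (union (vertex fresh) e))

  advanceTo : ∀ {m} → ℕ → ℕ → CWExpr width m → CWExpr width m
  advanceTo t t′ = relabel (encode ∘ advance t t′ ∘ decode)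

  Realises : ℕ → (ws : List V) → CWExpr width (length ws) → Set
  Realises t ws e = (∀ x → label e x ≡ old (encode (labelAt t (lookup ws x))))
                  × (∀ x y → edge e x y ≡ adj G (lookup ws x) (lookup ws y))

  realises-advance : ∀ {t t′} ws e → Realises t ws e → All (λ u → key u ≤ t) ws → t ≤ t′ →
                     Realises t′ ws (advanceTo t t′ e)
  realises-advance {t} {t′} ws e (labels , edges) early t≤t′ = labels′ , edges′
    where
    labels′ : ∀ x → label (advanceTo t t′ e) x ≡ old (encode (labelAt t′ (lookup ws x)))
    labels′ x rewrite label-relabel (encode ∘ advance t t′ ∘ decode) e x _ (labels x)
                    | decode-encode (labelAt t (lookup ws x))
                    | labelAt-advance (lookup ws x) t t′ (All.lookup early (∈-lookup x)) t≤t′ = refl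
    edges′ : ∀ x y → edge (advanceTo t t′ e) x y ≡ adj G (lookup ws x) (lookup ws y)
    edges′ x y = trans (edge-relabel _ e x y) (edges x y)

  module Insertion (w : V) (ws : List V) (e : CWExpr width (length ws)) (realised : Realises (key w) ws e)
                   (new : All (w ≢_) ws) (early : All (λ u → key u ≤ key w) ws) where
    β = joinsTo w ∘ decode
    e₁ = union (vertex fresh) e
    e₂ = joinAll β (allFin L) e₁
    own = old (encode (labelAt (key w) w))
    open ≡-Reasoning

    code : Fin (length ws) → Fin L
    code x = encode (labelAt (key w) (lookup ws x))

    labels : ∀ x → label e x ≡ old (code x)
    labels = proj₁ realised

    labels′ : ∀ x → label (insert w e) x ≡ old (encode (labelAt (key w) (lookup (w ∷ ws) x)))
    labels′ zero = trans (label-rename fresh own e₂ zero)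
      (trans (cong (substitute (fresh , own)) (label-joinAll β (allFin L) e₁ zero)) (substitute-hit fresh own))
    labels′ (suc x) = trans (label-rename fresh own e₂ (suc x))
      (trans (cong (substitute (fresh , own)) (trans (label-joinAll β (allFin L) e₁ (suc x)) (labels x)))
        (substitute-miss {j = own} (old≢fresh {code x})))

    joined : ∀ x → β (code x) ≡ adj G (lookup ws x) w
    joined x = trans (cong (joinsTo w) (decode-encode _))
      (sym (adj-labelAt u w (λ u≡w → All.lookup new u∈ws (sym u≡w)) (All.lookup early u∈ws)))
      where
      u = lookup ws x
      u∈ws = ∈-lookup x

    linked : Fin width → Fin width → Bool
    linked a b = any (λ c → β c ∧ links c a b) (allFin L)

    edge-via : ∀ x y {a b} → label e₁ x ≡ a → label e₁ y ≡ b → edge (insert w e) x y ≡ edge e₁ x y ∨ linked a b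
    edge-via x y lx ly = trans (edge-joinAll β (allFin L) e₁ x y) (cong₂ (λ a b → edge e₁ x y ∨ linked a b) lx ly)

    edges′ : ∀ x y → edge (insert w e) x y ≡ adj G (lookup (w ∷ ws) x) (lookup (w ∷ ws) y)
    edges′ zero zero = begin
      edge (insert w e) zero zero              ≡⟨ edge-via zero zero refl refl ⟩
      linked fresh fresh                       ≡⟨ no-links β fresh fresh links-fresh-fresh ⟩
      false                                    ≡⟨ sym (irrefl G w) ⟩
      adj G w w                                ∎
    edges′ zero (suc y) = begin
      edge (insert w e) zero (suc y)           ≡⟨ edge-via zero (suc y) refl (labels y) ⟩
      linked fresh (old (code y))              ≡⟨ links-fresh-old β (code y) ⟩
      β (code y)                               ≡⟨ joined y ⟩
      adj G (lookup ws y) w                    ≡⟨ Graph.sym G (lookup ws y) w ⟩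
      adj G w (lookup ws y)                    ∎
    edges′ (suc x) zero = begin
      edge (insert w e) (suc x) zero           ≡⟨ edge-via (suc x) zero (labels x) refl ⟩
      linked (old (code x)) fresh              ≡⟨ links-old-fresh β (code x) ⟩
      β (code x)                               ≡⟨ joined x ⟩
      adj G (lookup ws x) w                    ∎
    edges′ (suc x) (suc y) = begin
      edge (insert w e) (suc x) (suc y)        ≡⟨ edge-via (suc x) (suc y) (labels x) (labels y) ⟩
      edge e x y ∨ linked (old (code x)) (old (code y))
        ≡⟨ cong (edge e x y ∨_) (no-links β (old (code x)) (old (code y)) (λ c → links-old-old c (code x) (code y))) ⟩
      edge e x y ∨ false                       ≡⟨ ∨-identityʳ _ ⟩
      edge e x y                               ≡⟨ proj₂ realised x y ⟩
      adj G (lookup ws x) (lookup ws y)        ∎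

  realises-insert : ∀ w ws e → Realises (key w) ws e → All (w ≢_) ws → All (λ u → key u ≤ key w) ws →
                    Realises (key w) (w ∷ ws) (insert w e)
  realises-insert w ws e realised new early = labels′ , edges′
    where open Insertion w ws e realised new early

  -- The vertices inserted so far, the most recent first; time of the list.
  time : List V → ℕ
  time [] = 0
  time (w ∷ _) = key w

  build : (ws : List V) → CWExpr width (length ws)
  build [] = empty
  build (w ∷ ws) = insert w (advanceTo (time ws) (key w) (build ws))

  bounded-by-time : ∀ ws → AllPairs (λ w u → key u ≤ key w) ws → All (λ u → key u ≤ time ws) ws
  bounded-by-time [] [] = []
  bounded-by-time (w ∷ ws) (w≥ws ∷ _) = ≤-refl ∷ w≥ws

  time≤key : ∀ w ws → All (λ u → key u ≤ key w) ws → time ws ≤ key w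
  time≤key w [] [] = z≤n
  time≤key w (u ∷ ws) (u≤w ∷ _) = u≤w

  build-realises : ∀ ws → AllPairs (λ w u → key u ≤ key w) ws → Unique ws → Realises (time ws) ws (build ws)
  build-realises [] [] [] = (λ ()) , (λ ())
  build-realises (w ∷ ws) (w≥ws ∷ sorted) (w∉ws ∷ unique) =
    realises-insert w ws _
      (realises-advance ws (build ws) (build-realises ws sorted unique) (bounded-by-time ws sorted) (time≤key w ws w≥ws))
      w∉ws w≥ws

  byKey : DecTotalOrder _ _ _
  byKey = Flip.decTotalOrder (On.decTotalOrder ≤-decTotalOrder key)

  module Descending = Data.List.Sort byKey

  descending : List V
  descending = Descending.sort (allFin (n G))

  linear-cw : CWAtMost width G
  linear-cw = enumeration⇒cw G descending (Descending.sort-↭ _) (build descending)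
    (proj₂ (build-realises descending (Sorted⇒AllPairs (DecTotalOrder.totalOrder byKey) (Descending.sort-↗ (allFin (n G))))
                                      (enumeration-unique descending (Descending.sort-↭ _))))

linearScheme⇒cw : ∀ {G Λ L} → Coding Λ L → LinearScheme G Λ → CWAtMost (suc (L + L)) G
linearScheme⇒cw coding S = Construction.linear-cw coding S

Separated : (H : Graph) → Fin (n H) → Fin (n H) → Set
Separated H i j = i ≡ j ⊎ adj H i j ≡ true ⊎ ∃ λ k → adj H i k ≢ adj H j k

true≢false : true ≢ false
true≢false ()

adj-flip : ∀ (G : Graph) {x y b} → adj G x y ≡ b → adj G y x ≡ b
adj-flip G {x} {y} xy = trans (Graph.sym G y x) xy

distinguished : ∀ (G : Graph) {x y z} → adj G z x ≡ true → adj G z y ≡ false → x ≢ y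
distinguished G zx zy refl = true≢false (trans (sym zx) zy)

module _ (H G : Graph) (f : Fin (n H) → Fin (n G)) (preserves : ∀ i j → adj H i j ≡ adj G (f i) (f j)) where

  identified-non-adjacent : ∀ {i j} → f i ≡ f j → adj H i j ≡ false
  identified-non-adjacent {i} {j} fi≡fj = trans (preserves i j) (trans (cong (adj G (f i)) (sym fi≡fj)) (irrefl G (f i)))

  identified-twins : ∀ {i j} → f i ≡ f j → ∀ k → adj H i k ≡ adj H j k
  identified-twins {i} {j} fi≡fj k = trans (preserves i k) (trans (cong (λ v → adj G v (f k)) fi≡fj) (sym (preserves j k)))

  preserving⇒injective : (∀ i j → Separated H i j) → Injective _≡_ _≡_ f
  preserving⇒injective separated {i} {j} fi≡fj with separated i j
  ... | inj₁ i≡j = i≡j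
  ... | inj₂ (inj₁ i~j) = contradiction (trans (sym i~j) (identified-non-adjacent fi≡fj)) true≢false
  ... | inj₂ (inj₂ (k , differ)) = contradiction (identified-twins fi≡fj k) differ

paw-separated : ∀ i j → Separated P₁+paw i j
paw-separated = from-yes (all? λ i → all? λ j →
  (i ≟ j) ⊎-dec (p1pawAdj i j Bool.≟ true) ⊎-dec any? (λ k → ¬? (p1pawAdj i k Bool.≟ p1pawAdj j k)))

module _ (G : Graph) where
  private
    V = Fin (n G)
    A = adj G

  induced-P₁+paw : (v a b c d : V) →
    A v a ≡ false → A v b ≡ false → A v c ≡ false → A v d ≡ false →
    A a b ≡ true → A a c ≡ true → A b c ≡ true → A c d ≡ true → A a d ≡ false → A b d ≡ false →
    InducedSubgraph P₁+paw G
  induced-P₁+paw v a b c d va vb vc vd ab ac bc cd ad bd =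
    f , preserving⇒injective P₁+paw G f preserves paw-separated , preserves
    where
    f : Fin 5 → V
    f zero = v
    f (suc zero) = a
    f (suc (suc zero)) = b
    f (suc (suc (suc zero))) = c
    f (suc (suc (suc (suc zero)))) = d

    transposed : ∀ {x y b} → A x y ≡ b → b ≡ A y x
    transposed xy = sym (adj-flip G xy)

    preserves : ∀ i j → p1pawAdj i j ≡ A (f i) (f j)
    preserves zero zero = sym (irrefl G v)
    preserves zero (suc zero) = sym va
    preserves zero (suc (suc zero)) = sym vb
    preserves zero (suc (suc (suc zero))) = sym vc
    preserves zero (suc (suc (suc (suc zero)))) = sym vd
    preserves (suc zero) zero = transposed va
    preserves (suc zero) (suc zero) = sym (irrefl G a)
    preserves (suc zero) (suc (suc zero)) = sym ab
    preserves (suc zero) (suc (suc (suc zero))) = sym ac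
    preserves (suc zero) (suc (suc (suc (suc zero)))) = sym ad
    preserves (suc (suc zero)) zero = transposed vb
    preserves (suc (suc zero)) (suc zero) = transposed ab
    preserves (suc (suc zero)) (suc (suc zero)) = sym (irrefl G b)
    preserves (suc (suc zero)) (suc (suc (suc zero))) = sym bc
    preserves (suc (suc zero)) (suc (suc (suc (suc zero)))) = sym bd
    preserves (suc (suc (suc zero))) zero = transposed vc
    preserves (suc (suc (suc zero))) (suc zero) = transposed ac
    preserves (suc (suc (suc zero))) (suc (suc zero)) = transposed bc
    preserves (suc (suc (suc zero))) (suc (suc (suc zero))) = sym (irrefl G c)
    preserves (suc (suc (suc zero))) (suc (suc (suc (suc zero)))) = sym cd
    preserves (suc (suc (suc (suc zero)))) zero = transposed vd
    preserves (suc (suc (suc (suc zero)))) (suc zero) = transposed ad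
    preserves (suc (suc (suc (suc zero)))) (suc (suc zero)) = transposed bd
    preserves (suc (suc (suc (suc zero)))) (suc (suc (suc zero))) = transposed cd
    preserves (suc (suc (suc (suc zero)))) (suc (suc (suc (suc zero)))) = sym (irrefl G d)

-- The first element of Fin m satisfying a decidable predicate.  It is a canonical
-- choice: it depends only on the extension of the predicate (first-cong).
first : ∀ {m} {P : Fin m → Set} → Decidable P → Maybe (Fin m)
first {zero} P? = nothing
first {suc m} P? with P? zero
... | yes _ = just zero
... | no _ = Maybe.map suc (first (λ i → P? (suc i)))

first-just : ∀ {m} {P : Fin m → Set} (P? : Decidable P) {i} → first P? ≡ just i → P i
first-just {suc m} P? eq with P? zero
first-just {suc m} P? refl | yes p = p
first-just {suc m} P? eq | no _ with first (λ i → P? (suc i)) in eq′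
first-just {suc m} P? refl | no _ | just j = first-just (λ i → P? (suc i)) eq′

first-nothing : ∀ {m} {P : Fin m → Set} (P? : Decidable P) → first P? ≡ nothing → ∀ i → ¬ P i
first-nothing {suc m} P? eq i with P? zero
first-nothing {suc m} P? () i | yes _
first-nothing {suc m} P? eq zero | no ¬p = ¬p
first-nothing {suc m} P? eq (suc i) | no _ with first (λ i → P? (suc i)) in eq′
first-nothing {suc m} P? eq (suc i) | no _ | nothing = first-nothing (λ i → P? (suc i)) eq′ i

first-cong : ∀ {m} {P Q : Fin m → Set} (P? : Decidable P) (Q? : Decidable Q) →
             (∀ i → P i → Q i) → (∀ i → Q i → P i) → first P? ≡ first Q?
first-cong {zero} P? Q? _ _ = refl
first-cong {suc m} P? Q? P⇒Q Q⇒P with P? zero | Q? zero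
... | yes _ | yes _ = refl
... | no _ | no _ = cong (Maybe.map suc)
  (first-cong (λ i → P? (suc i)) (λ i → Q? (suc i)) (λ i → P⇒Q (suc i)) (λ i → Q⇒P (suc i)))
... | yes p | no ¬q = contradiction (P⇒Q zero p) ¬q
... | no ¬p | yes q = contradiction (Q⇒P zero q) ¬p

-- Doubling, and the last time of the two-step phase containing a given time.
dbl : ℕ → ℕ
dbl zero = zero
dbl (suc n) = suc (suc (dbl n))

dbl-mono : ∀ {a b} → a ≤ b → dbl a ≤ dbl b
dbl-mono z≤n = z≤n
dbl-mono (s≤s a≤b) = s≤s (s≤s (dbl-mono a≤b))

dbl-cancel : ∀ {a b} → dbl a ≤ suc (dbl b) → a ≤ b
dbl-cancel {zero} _ = z≤n
dbl-cancel {suc a} {zero} (s≤s ())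
dbl-cancel {suc a} {suc b} (s≤s (s≤s le)) = s≤s (dbl-cancel le)

phaseEnd : ℕ → ℕ
phaseEnd zero = 1
phaseEnd (suc zero) = 1
phaseEnd (suc (suc t)) = suc (suc (phaseEnd t))

phaseEnd-dbl : ∀ y t → dbl y ≤ t → t ≤ suc (dbl y) → phaseEnd t ≡ suc (dbl y)
phaseEnd-dbl zero zero _ _ = refl
phaseEnd-dbl zero (suc zero) _ _ = refl
phaseEnd-dbl zero (suc (suc t)) _ (s≤s ())
phaseEnd-dbl (suc y) (suc (suc t)) (s≤s (s≤s lo)) (s≤s (s≤s hi)) = cong (λ e → suc (suc e)) (phaseEnd-dbl y t lo hi)

data OrdinaryKind : Set where
  current-petal missed-by-B seen-by-all independent : OrdinaryKind

data Kind : Set where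
  special₁ special₂ : Kind
  ordinary : OrdinaryKind → Kind

kind-coding : Coding Kind 6
kind-coding = record { encode = encode ; decode = decode ; decode-encode = decode-encode }
  where
  encode : Kind → Fin 6
  encode special₁ = zero
  encode special₂ = suc zero
  encode (ordinary current-petal) = suc (suc zero)
  encode (ordinary missed-by-B) = suc (suc (suc zero))
  encode (ordinary seen-by-all) = suc (suc (suc (suc zero)))
  encode (ordinary independent) = suc (suc (suc (suc (suc zero))))

  decode : Fin 6 → Kind
  decode zero = special₁
  decode (suc zero) = special₂
  decode (suc (suc zero)) = ordinary current-petal
  decode (suc (suc (suc zero))) = ordinary missed-by-B
  decode (suc (suc (suc (suc zero)))) = ordinary seen-by-all
  decode (suc (suc (suc (suc (suc zero))))) = ordinary independent

  decode-encode : ∀ c → decode (encode c) ≡ c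
  decode-encode special₁ = refl
  decode-encode special₂ = refl
  decode-encode (ordinary current-petal) = refl
  decode-encode (ordinary missed-by-B) = refl
  decode-encode (ordinary seen-by-all) = refl
  decode-encode (ordinary independent) = refl

-- A clique vertex of the petal being processed stays `current` until the end e of its phase.
activeUntil : ℕ → ℕ → OrdinaryKind
activeUntil e t = if does (t ≤? e) then current-petal else missed-by-B

activeUntil-≤ : ∀ {e t} → t ≤ e → activeUntil e t ≡ current-petal
activeUntil-≤ {e} {t} t≤e rewrite dec-true (t ≤? e) t≤e = refl

activeUntil-> : ∀ {e t} → e < t → activeUntil e t ≡ missed-by-B
activeUntil-> {e} {t} e<t rewrite dec-false (t ≤? e) (<⇒≱ e<t) = refl

-- A split graph G with clique part K (part = true) and independent part I, two
-- special vertices s₁ s₂, and a subset inA of I; I ∩ inA is called A and the rest of I is B.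
module Petals (G : Graph) (part : Fin (n G) → Bool)
  (clique : ∀ i j → i ≢ j → part i ≡ true → part j ≡ true → adj G i j ≡ true)
  (indep : ∀ i j → part i ≡ false → part j ≡ false → adj G i j ≡ false)
  (s₁ s₂ : Fin (n G)) (inA : Fin (n G) → Bool) where

  V : Set
  V = Fin (n G)

  Special : V → Set
  Special k = k ≡ s₁ ⊎ k ≡ s₂

  Misses : V → V → Set
  Misses x k = part k ≡ true × ¬ Special k × adj G x k ≡ false

  InA InB : V → Set
  InA x = part x ≡ false × inA x ≡ true
  InB x = part x ≡ false × inA x ≡ false

  record PetalConditions : Set where
    field
      petals : ∀ {x y k k′} → InA x → InA y → Misses x k → Misses y k → Misses x k′ → Misses y k′
      B-misses-petals : ∀ {b x k} → InB b → InA x → Misses x k → Misses b k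
      B-uniform : ∀ {b b′ k} → InB b → InB b′ → Misses b k → Misses b′ k

  misses? : ∀ x k → Dec (Misses x k)
  misses? x k = (part k Bool.≟ true) ×-dec ¬? ((k ≟ s₁) ⊎-dec (k ≟ s₂)) ×-dec (adj G x k Bool.≟ false)

  inA? : Decidable InA
  inA? x = (part x Bool.≟ false) ×-dec (inA x Bool.≟ true)

  inB? : Decidable InB
  inB? x = (part x Bool.≟ false) ×-dec (inA x Bool.≟ false)

  misses⇒nonadjacent : ∀ {x k} → Misses x k → adj G x k ≡ false
  misses⇒nonadjacent (_ , _ , xk) = xk

  misses-intro : ∀ {x k} → part k ≡ true → ¬ Special k → ¬ adj G x k ≡ true → Misses x k
  misses-intro pk ¬sk ¬xk = pk , ¬sk , Bool.¬-not ¬xk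

  not-missed⇒adjacent : ∀ {x k} → part k ≡ true → ¬ Special k → ¬ Misses x k → adj G x k ≡ true
  not-missed⇒adjacent {x} {k} pk ¬sk ¬m with adj G x k
  ... | true = refl
  ... | false = contradiction (pk , ¬sk , refl) ¬m

  module Scheme (conditions : PetalConditions) where
    open PetalConditions conditions

    -- The petal of a clique vertex k is named by the first A-vertex missing k.
    representative : V → Maybe V
    representative k = first (λ y → inA? y ×-dec misses? y k)

    representative-misses : ∀ {k y} → representative k ≡ just y → InA y × Misses y k
    representative-misses {k} = first-just (λ y → inA? y ×-dec misses? y k)

    unmissed : ∀ {k x} → representative k ≡ nothing → InA x → ¬ Misses x k
    unmissed {k} {x} r x∈A m = first-nothing (λ y → inA? y ×-dec misses? y k) r x (x∈A , m)

    same-petal : ∀ {x k k′} → InA x → Misses x k → Misses x k′ → representative k ≡ representative k′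
    same-petal x∈A xk xk′ = first-cong _ _
      (λ y (y∈A , yk) → y∈A , petals x∈A y∈A xk yk xk′)
      (λ y (y∈A , yk′) → y∈A , petals x∈A y∈A xk′ yk′ xk)

    data Ordinary (u : V) : Set where
      petal-clique : (y : V) → part u ≡ true → representative u ≡ just y → Ordinary u
      rest-missed : part u ≡ true → representative u ≡ nothing → (b : V) → InB b → Misses b u → Ordinary u
      rest-seen : part u ≡ true → representative u ≡ nothing → (∀ b → InB b → ¬ Misses b u) → Ordinary u
      petal-A : (k y : V) → InA u → Misses u k → representative k ≡ just y → Ordinary u
      full-A : InA u → (∀ k → ¬ Misses u k) → Ordinary u
      B-vertex : InB u → Ordinary u

    data Class (u : V) : Set where
      is-s₁ : u ≡ s₁ → Class u
      is-s₂ : u ≢ s₁ → u ≡ s₂ → Class u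
      ordinary : ¬ Special u → Ordinary u → Class u

    classify-clique : ∀ u → part u ≡ true → Ordinary u
    classify-clique u pu with representative u in r
    ... | just y = petal-clique y pu r
    ... | nothing with any? (λ b → inB? b ×-dec misses? b u)
    ...   | yes (b , b∈B , bu) = rest-missed pu r b b∈B bu
    ...   | no none = rest-seen pu r (λ b b∈B bu → none (b , b∈B , bu))

    classify-A : ∀ u → InA u → Ordinary u
    classify-A u u∈A with any? (misses? u)
    ... | no none = full-A u∈A (λ k uk → none (k , uk))
    ... | yes (k , uk) with representative k in r
    ...   | just y = petal-A k y u∈A uk r
    ...   | nothing = contradiction uk (unmissed r u∈A)

    classify-ordinary : ∀ u → Ordinary u
    classify-ordinary u with part u in pu | inA u in au
    ... | true | _ = classify-clique u pu
    ... | false | true = classify-A u (pu , au)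
    ... | false | false = B-vertex (pu , au)

    classify : ∀ u → Class u
    classify u with u ≟ s₁
    ... | yes u≡s₁ = is-s₁ u≡s₁
    ... | no u≢s₁ with u ≟ s₂
    ...   | yes u≡s₂ = is-s₂ u≢s₁ u≡s₂
    ...   | no u≢s₂ = ordinary [ u≢s₁ , u≢s₂ ]′ (classify-ordinary u)

    -- Insertion times: the specials first, then phase by phase the clique vertices
    -- of a petal followed by the A-vertices missing it, then the A-vertices missing
    -- nothing, the remaining clique vertices, and finally B.
    ordinaryKey : ∀ {u} → Ordinary u → ℕ
    ordinaryKey (petal-clique y _ _) = dbl (toℕ y)
    ordinaryKey (petal-A _ y _ _ _) = suc (dbl (toℕ y))
    ordinaryKey (full-A _ _) = dbl (n G)
    ordinaryKey (rest-missed _ _ _ _ _) = suc (dbl (n G))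
    ordinaryKey (rest-seen _ _ _) = suc (dbl (n G))
    ordinaryKey (B-vertex _) = suc (suc (dbl (n G)))

    classKey : ∀ {u} → Class u → ℕ
    classKey (is-s₁ _) = 0
    classKey (is-s₂ _ _) = 1
    classKey (ordinary _ o) = 2 + ordinaryKey o

    ordinaryLabel : ∀ {u} → ℕ → Ordinary u → OrdinaryKind
    ordinaryLabel t (petal-clique y _ _) = activeUntil (3 + dbl (toℕ y)) t
    ordinaryLabel t (rest-missed _ _ _ _ _) = missed-by-B
    ordinaryLabel t (rest-seen _ _ _) = seen-by-all
    ordinaryLabel t (petal-A _ _ _ _ _) = independent
    ordinaryLabel t (full-A _ _) = independent
    ordinaryLabel t (B-vertex _) = independent

    classLabel : ∀ {u} → ℕ → Class u → Kind
    classLabel t (is-s₁ _) = special₁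
    classLabel t (is-s₂ _ _) = special₂
    classLabel t (ordinary _ o) = ordinary (ordinaryLabel t o)

    seenByA seenByB : OrdinaryKind → Bool
    seenByA missed-by-B = true
    seenByA seen-by-all = true
    seenByA _ = false
    seenByB seen-by-all = true
    seenByB _ = false

    -- The ordinary labels a newly inserted vertex is joined to: a clique vertex to all
    -- of them, an A-vertex to the clique vertices outside the current petal, a B-vertex
    -- to the clique vertices missed by no independent vertex.
    ordinaryJoins : ∀ {w} → Ordinary w → OrdinaryKind → Bool
    ordinaryJoins (petal-clique _ _ _) _ = true
    ordinaryJoins (rest-missed _ _ _ _ _) _ = true
    ordinaryJoins (rest-seen _ _ _) _ = true
    ordinaryJoins (petal-A _ _ _ _ _) = seenByA
    ordinaryJoins (full-A _ _) = seenByA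
    ordinaryJoins (B-vertex _) = seenByB

    -- A special vertex precedes every ordinary vertex, so it never joins ordinary labels.
    classJoins : ∀ {w} → Class w → Kind → Bool
    classJoins {w} _ special₁ = adj G w s₁
    classJoins {w} _ special₂ = adj G w s₂
    classJoins (ordinary _ o) (ordinary c) = ordinaryJoins o c
    classJoins _ (ordinary _) = false

    advance : ℕ → ℕ → Kind → Kind
    advance t t′ (ordinary current-petal) = ordinary (activeUntil (phaseEnd t) t′)
    advance t t′ c = c

    petal-bound : ∀ (y : V) → suc (dbl (toℕ y)) < dbl (n G)
    petal-bound y = dbl-mono (toℕ<n y)

    after-petals : ∀ (y : V) {k} → dbl (n G) ≤ k → k ≤ suc (dbl (toℕ y)) → ⊥
    after-petals y N≤k k≤y = <⇒≱ (petal-bound y) (≤-trans N≤k k≤y)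

    late-label : ∀ (y : V) {t} → dbl (n G) ≤ t → activeUntil (3 + dbl (toℕ y)) (2 + t) ≡ missed-by-B
    late-label y N≤t = activeUntil-> (s≤s (s≤s (<-≤-trans (petal-bound y) N≤t)))

    into-petal-clique : ∀ {u w} (ou : Ordinary u) yw → part w ≡ true → ¬ Special w → representative w ≡ just yw →
                        u ≢ w → ordinaryKey ou ≤ dbl (toℕ yw) → adj G u w ≡ true
    into-petal-clique (petal-clique _ pu _) yw pw _ _ u≢w _ = clique _ _ u≢w pu pw
    into-petal-clique (rest-missed _ _ _ _ _) yw _ _ _ _ le = ⊥-elim (after-petals yw (n≤1+n _) (m≤n⇒m≤1+n le))
    into-petal-clique (rest-seen _ _ _) yw _ _ _ _ le = ⊥-elim (after-petals yw (n≤1+n _) (m≤n⇒m≤1+n le))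
    into-petal-clique (petal-A k yu u∈A uk rk) yw pw ¬sw rw _ le = not-missed⇒adjacent pw ¬sw other-petal
      where
      other-petal : ¬ Misses _ _
      other-petal uw with just-injective (trans (sym rk) (trans (same-petal u∈A uk uw) rw))
      ... | refl = contradiction le (<⇒≱ (n<1+n _))
    into-petal-clique (full-A _ none) yw pw ¬sw _ _ _ = not-missed⇒adjacent pw ¬sw (none _)
    into-petal-clique (B-vertex _) yw _ _ _ _ le = ⊥-elim (after-petals yw (m≤n+m _ 2) (m≤n⇒m≤1+n le))

    into-rest : ∀ {u w} (ou : Ordinary u) → part w ≡ true → ¬ Special w → representative w ≡ nothing →
                u ≢ w → ordinaryKey ou ≤ suc (dbl (n G)) → adj G u w ≡ true
    into-rest (petal-clique _ pu _) pw _ _ u≢w _ = clique _ _ u≢w pu pw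
    into-rest (rest-missed pu _ _ _ _) pw _ _ u≢w _ = clique _ _ u≢w pu pw
    into-rest (rest-seen pu _ _) pw _ _ u≢w _ = clique _ _ u≢w pu pw
    into-rest (petal-A _ _ u∈A _ _) pw ¬sw rw _ _ = not-missed⇒adjacent pw ¬sw (unmissed rw u∈A)
    into-rest (full-A _ none) pw ¬sw _ _ _ = not-missed⇒adjacent pw ¬sw (none _)
    into-rest (B-vertex _) _ _ _ _ le = contradiction le (<⇒≱ (n<1+n _))

    -- Adjacency of an A-vertex w of petal y_w: it misses exactly the clique vertices of its own petal.
    into-petal-A : ∀ {u w} (ou : Ordinary u) → ¬ Special u → ∀ kw yw → InA w → Misses w kw → representative kw ≡ just yw →
                   ordinaryKey ou ≤ suc (dbl (toℕ yw)) → adj G u w ≡ seenByA (ordinaryLabel (3 + dbl (toℕ yw)) ou)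
    into-petal-A (petal-clique yu pu ru) ¬su kw yw w∈A wkw rkw le with 3 + dbl (toℕ yw) ≤? 3 + dbl (toℕ yu)
    ... | yes current rewrite activeUntil-≤ current = adj-flip G (misses⇒nonadjacent w-misses-u)
      where
      yu≡yw : yu ≡ yw
      yu≡yw = toℕ-injective (≤-antisym (dbl-cancel le) (dbl-cancel (m≤n⇒m≤1+n (≤-pred (≤-pred (≤-pred current))))))
      yw-misses-u : InA yw × Misses yw _
      yw-misses-u = representative-misses (trans ru (cong just yu≡yw))
      w-misses-u : Misses _ _
      w-misses-u = petals (proj₁ yw-misses-u) w∈A (proj₂ (representative-misses rkw)) wkw (proj₂ yw-misses-u)
    ... | no passed rewrite activeUntil-> (≰⇒> passed) = adj-flip G (not-missed⇒adjacent pu ¬su other-petal)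
      where
      other-petal : ¬ Misses _ _
      other-petal wu with just-injective (trans (sym rkw) (trans (same-petal w∈A wkw wu) ru))
      ... | refl = passed ≤-refl
    into-petal-A (rest-missed _ _ _ _ _) _ _ yw _ _ _ le = ⊥-elim (after-petals yw (n≤1+n _) le)
    into-petal-A (rest-seen _ _ _) _ _ yw _ _ _ le = ⊥-elim (after-petals yw (n≤1+n _) le)
    into-petal-A (petal-A _ _ (pu , _) _ _) _ _ _ (pw , _) _ _ _ = indep _ _ pu pw
    into-petal-A (full-A (pu , _) _) _ _ _ (pw , _) _ _ _ = indep _ _ pu pw
    into-petal-A (B-vertex (pu , _)) _ _ _ (pw , _) _ _ _ = indep _ _ pu pw

    -- Adjacency of an A-vertex w missing nothing: all petals are closed when it is inserted.
    into-full-A : ∀ {u w} (ou : Ordinary u) → ¬ Special u → InA w → (∀ k → ¬ Misses w k) →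
                  ordinaryKey ou ≤ dbl (n G) → adj G u w ≡ seenByA (ordinaryLabel (2 + dbl (n G)) ou)
    into-full-A (petal-clique yu pu _) ¬su _ none _ rewrite late-label yu {dbl (n G)} ≤-refl =
      adj-flip G (not-missed⇒adjacent pu ¬su (none _))
    into-full-A (rest-missed _ _ _ _ _) _ _ _ le = contradiction le (<⇒≱ (n<1+n _))
    into-full-A (rest-seen _ _ _) _ _ _ le = contradiction le (<⇒≱ (n<1+n _))
    into-full-A (petal-A _ _ (pu , _) _ _) _ (pw , _) _ _ = indep _ _ pu pw
    into-full-A (full-A (pu , _) _) _ (pw , _) _ _ = indep _ _ pu pw
    into-full-A (B-vertex (pu , _)) _ (pw , _) _ _ = indep _ _ pu pw

    -- Adjacency of a B-vertex w, inserted last: it sees exactly the clique vertices missed by no independent vertex.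
    into-B : ∀ {u w} (ou : Ordinary u) → ¬ Special u → InB w → adj G u w ≡ seenByB (ordinaryLabel (4 + dbl (n G)) ou)
    into-B (petal-clique yu pu ru) _ w∈B rewrite late-label yu {suc (suc (dbl (n G)))} (m≤n+m _ 2) =
      adj-flip G (misses⇒nonadjacent (B-misses-petals w∈B (proj₁ (representative-misses ru)) (proj₂ (representative-misses ru))))
    into-B (rest-missed _ _ b b∈B bu) _ w∈B = adj-flip G (misses⇒nonadjacent (B-uniform b∈B w∈B bu))
    into-B (rest-seen pu _ none) ¬su w∈B = adj-flip G (not-missed⇒adjacent pu ¬su (none _ w∈B))
    into-B (petal-A _ _ (pu , _) _ _) _ (pw , _) = indep _ _ pu pw
    into-B (full-A (pu , _) _) _ (pw , _) = indep _ _ pu pw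
    into-B (B-vertex (pu , _)) _ (pw , _) = indep _ _ pu pw

    correct : ∀ {u w} (cu : Class u) (cw : Class w) → u ≢ w → classKey cu ≤ classKey cw →
              adj G u w ≡ classJoins cw (classLabel (classKey cw) cu)
    correct (is-s₁ refl) _ _ _ = Graph.sym G _ _
    correct (is-s₂ _ refl) _ _ _ = Graph.sym G _ _
    correct (ordinary _ _) (is-s₁ _) _ ()
    correct (ordinary _ _) (is-s₂ _ _) _ (s≤s ())
    correct (ordinary _ ou) (ordinary ¬sw (petal-clique yw pw rw)) u≢w (s≤s (s≤s le)) = into-petal-clique ou yw pw ¬sw rw u≢w le
    correct (ordinary _ ou) (ordinary ¬sw (rest-missed pw rw _ _ _)) u≢w (s≤s (s≤s le)) = into-rest ou pw ¬sw rw u≢w le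
    correct (ordinary _ ou) (ordinary ¬sw (rest-seen pw rw _)) u≢w (s≤s (s≤s le)) = into-rest ou pw ¬sw rw u≢w le
    correct (ordinary ¬su ou) (ordinary _ (petal-A kw yw w∈A wkw rkw)) _ (s≤s (s≤s le)) = into-petal-A ou ¬su kw yw w∈A wkw rkw le
    correct (ordinary ¬su ou) (ordinary _ (full-A w∈A none)) _ (s≤s (s≤s le)) = into-full-A ou ¬su w∈A none le
    correct (ordinary ¬su ou) (ordinary _ (B-vertex w∈B)) _ _ = into-B ou ¬su w∈B

    -- Labels change only when a petal closes, and then uniformly.
    evolves : ∀ {u} (cu : Class u) t t′ → classKey cu ≤ t → t ≤ t′ → classLabel t′ cu ≡ advance t t′ (classLabel t cu)
    evolves (is-s₁ _) _ _ _ _ = refl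
    evolves (is-s₂ _ _) _ _ _ _ = refl
    evolves (ordinary _ (petal-clique y _ _)) t t′ start≤t t≤t′ with t ≤? 3 + dbl (toℕ y)
    ... | yes in-phase rewrite activeUntil-≤ in-phase | phaseEnd-dbl (suc (toℕ y)) t start≤t in-phase = refl
    ... | no closed rewrite activeUntil-> (≰⇒> closed) | activeUntil-> (<-≤-trans (≰⇒> closed) t≤t′) = refl
    evolves (ordinary _ (rest-missed _ _ _ _ _)) _ _ _ _ = refl
    evolves (ordinary _ (rest-seen _ _ _)) _ _ _ _ = refl
    evolves (ordinary _ (petal-A _ _ _ _ _)) _ _ _ _ = refl
    evolves (ordinary _ (full-A _ _)) _ _ _ _ = refl
    evolves (ordinary _ (B-vertex _)) _ _ _ _ = refl

    scheme : LinearScheme G Kind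
    scheme = record
      { key = λ u → classKey (classify u)
      ; labelAt = λ t u → classLabel t (classify u)
      ; advance = advance
      ; joinsTo = λ w → classJoins (classify w)
      ; adj-labelAt = λ u w → correct (classify u) (classify w)
      ; labelAt-advance = λ u → evolves (classify u)
      }

  petals⇒cw : PetalConditions → CWAtMost 13 G
  petals⇒cw conditions = linearScheme⇒cw kind-coding (Scheme.scheme conditions)

module SplitPawFree (G : Graph) (part : Fin (n G) → Bool)
  (clique : ∀ i j → i ≢ j → part i ≡ true → part j ≡ true → adj G i j ≡ true)
  (indep : ∀ i j → part i ≡ false → part j ≡ false → adj G i j ≡ false)
  (free : Free P₁+paw G) where

  private
    V = Fin (n G)
    A = adj G

  clique-triangle : ∀ {a b c d v} → part a ≡ true → part b ≡ true → part c ≡ true → part d ≡ false → part v ≡ false →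
    a ≢ b → A d c ≡ true → A d a ≡ false → A d b ≡ false → A v a ≡ false → A v b ≡ false → A v c ≡ false → ⊥
  clique-triangle {a} {b} {c} {d} {v} pa pb pc pd pv a≢b dc da db va vb vc =
    free (induced-P₁+paw G v a b c d va vb vc (indep v d pv pd)
      (clique a b a≢b pa pb) (clique a c a≢c pa pc) (clique b c b≢c pb pc) (adj-flip G dc) (adj-flip G da) (adj-flip G db))
    where
    a≢c : a ≢ c
    a≢c a≡c = distinguished G dc da (sym a≡c)
    b≢c : b ≢ c
    b≢c b≡c = distinguished G dc db (sym b≡c)

  split-triangle : ∀ {a b c d v} → part a ≡ true → part c ≡ true → part b ≡ false → part d ≡ false → part v ≡ false →
    A b a ≡ true → A b c ≡ true → A d c ≡ true → A d a ≡ false → A v a ≡ false → A v c ≡ false → ⊥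
  split-triangle {a} {b} {c} {d} {v} pa pc pb pd pv ba bc dc da va vc =
    free (induced-P₁+paw G v a b c d va (indep v b pv pb) vc (indep v d pv pd)
      (adj-flip G ba) (clique a c a≢c pa pc) bc (adj-flip G dc) (adj-flip G da) (indep b d pb pd))
    where
    a≢c : a ≢ c
    a≢c a≡c = distinguished G dc da (sym a≡c)

  Discord : V → V → V → V → Set
  Discord d v a c = part d ≡ false × part v ≡ false × part a ≡ true × part c ≡ true ×
                    A d a ≡ false × A v a ≡ false × A d c ≡ true × A v c ≡ false

  discord? : Dec (∃ λ d → ∃ λ v → ∃ λ a → ∃ λ c → Discord d v a c)
  discord? = any? λ d → any? λ v → any? λ a → any? λ c →
    (part d Bool.≟ false) ×-dec (part v Bool.≟ false) ×-dec (part a Bool.≟ true) ×-dec (part c Bool.≟ true) ×-dec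
    (A d a Bool.≟ false) ×-dec (A v a Bool.≟ false) ×-dec (A d c Bool.≟ true) ×-dec (A v c Bool.≟ false)

  -- Without a discord, I-vertices with a common non-neighbour have the same
  -- non-neighbours: all of I forms the A-part of a petal structure (any vertex z
  -- may serve as the special vertex).
  no-discord⇒cw : V → ¬ (∃ λ d → ∃ λ v → ∃ λ a → ∃ λ c → Discord d v a c) → CWAtMost 13 G
  no-discord⇒cw z none = petals⇒cw conditions
    where
    open Petals G part clique indep z z (λ _ → true)
    conditions : PetalConditions
    conditions = record
      { petals = λ {x} {y} {k} {k′} (px , _) (py , _) (pk , _ , xk) (_ , _ , yk) (pk′ , ¬sk′ , xk′) →
          misses-intro pk′ ¬sk′ λ yk′ → none (y , x , k , k′ , py , px , pk , pk′ , yk , xk , yk′ , xk′)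
      ; B-misses-petals = λ ()
      ; B-uniform = λ ()
      }

  module WithDiscord (d v a c : V) (pd : part d ≡ false) (pv : part v ≡ false) (pa : part a ≡ true) (pc : part c ≡ true)
    (da : A d a ≡ false) (va : A v a ≡ false) (dc : A d c ≡ true) (vc : A v c ≡ false) where

    Straggler : V → V → Set
    Straggler y c′ = part y ≡ false × A y a ≡ false × part c′ ≡ true × c′ ≢ a × c′ ≢ c × A y c′ ≡ false

    straggler? : Dec (∃ λ y → ∃ λ c′ → Straggler y c′)
    straggler? = any? λ y → any? λ c′ →
      (part y Bool.≟ false) ×-dec (A y a Bool.≟ false) ×-dec (part c′ Bool.≟ true) ×-dec
      ¬? (c′ ≟ a) ×-dec ¬? (c′ ≟ c) ×-dec (A y c′ Bool.≟ false)

    -- Without stragglers, all of I is the A-part of a petal structure with special vertices a and c.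
    no-straggler⇒cw : ¬ (∃ λ y → ∃ λ c′ → Straggler y c′) → CWAtMost 13 G
    no-straggler⇒cw none = petals⇒cw conditions
      where
      open Petals G part clique indep a c (λ _ → true)

      -- an I-vertex missing some k sees a (there is no straggler); with the discord it then misses c
      sees-a : ∀ {x k} → part x ≡ false → Misses x k → A x a ≡ true
      sees-a {x} {k} px (pk , ¬sk , xk) =
        Bool.¬-not λ xa → none (x , k , px , xa , pk , (λ k≡a → ¬sk (inj₁ k≡a)) , (λ k≡c → ¬sk (inj₂ k≡c)) , xk)

      misses-c : ∀ {x k} → part x ≡ false → Misses x k → A x c ≡ false
      misses-c px xk = Bool.¬-not λ xc → split-triangle pa pc px pd pv (sees-a px xk) xc dc da va vc

      conditions : PetalConditions
      conditions = record
        { petals = λ {x} {y} {k} {k′} (px , _) (py , _) xk yk (pk′ , ¬sk′ , xk′) →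
            misses-intro pk′ ¬sk′ λ yk′ →
              clique-triangle pc (proj₁ xk) pk′ py px (λ c≡k → proj₁ (proj₂ xk) (inj₂ (sym c≡k)))
                yk′ (misses-c py yk) (proj₂ (proj₂ yk)) (misses-c px xk) (proj₂ (proj₂ xk)) xk′
        ; B-misses-petals = λ ()
        ; B-uniform = λ ()
        }

    -- With a straggler (y₀, c′), the A-part consists of the I-vertices non-adjacent to a,
    -- and a is the only special vertex.
    straggler⇒cw : ∀ y₀ c′ → Straggler y₀ c′ → CWAtMost 13 G
    straggler⇒cw y₀ c′ (py₀ , y₀a , pc′ , c′≢a , c′≢c , y₀c′) = petals⇒cw conditions
      where
      open Petals G part clique indep a a (λ u → not (A u a))

      non-special : ∀ {k} → k ≢ a → ¬ Special k
      non-special k≢a (inj₁ k≡a) = k≢a k≡a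
      non-special k≢a (inj₂ k≡a) = k≢a k≡a

      nonadjacent-a : ∀ {x} → not (A x a) ≡ true → A x a ≡ false
      nonadjacent-a = Bool.not-injective

      adjacent-a : ∀ {x} → not (A x a) ≡ false → A x a ≡ true
      adjacent-a = Bool.not-injective

      -- A B-vertex sees a, so a neighbour k of it that is missed by an A-vertex
      -- would complete a forbidden configuration with d or v.
      B-misses-A : ∀ {b x k} → InB b → InA x → Misses x k → Misses b k
      B-misses-A {b} {x} {k} (pb , b∈B) (px , x∈A) (pk , ¬sk , xk) = misses-intro pk ¬sk excluded
        where
        a≢k : a ≢ k
        a≢k a≡k = ¬sk (inj₁ (sym a≡k))
        excluded : A b k ≡ true → ⊥
        excluded bk with A d k in dk | A v k in vk
        ... | true | _ = split-triangle pa pk pb pd px (adjacent-a b∈B) bk dk da (nonadjacent-a x∈A) xk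
        ... | false | true = split-triangle pa pk pb pv px (adjacent-a b∈B) bk vk va (nonadjacent-a x∈A) xk
        ... | false | false = clique-triangle pa pk pc pd pv a≢k dc da dk va vk vc

      -- v and y₀ are A-vertices missing c and c′ respectively; so every B-vertex misses both.
      v-misses-c : Misses v c
      v-misses-c = pc , non-special (distinguished G dc da) , vc

      y₀-misses-c′ : Misses y₀ c′
      y₀-misses-c′ = pc′ , non-special c′≢a , y₀c′

      B-misses-c : ∀ {b} → InB b → A b c ≡ false
      B-misses-c b∈B = misses⇒nonadjacent (B-misses-A b∈B (pv , cong not va) v-misses-c)

      B-misses-c′ : ∀ {b} → InB b → A b c′ ≡ false
      B-misses-c′ b∈B = misses⇒nonadjacent (B-misses-A b∈B (py₀ , cong not y₀a) y₀-misses-c′)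

      conditions : PetalConditions
      conditions = record
        { petals = λ (px , x∈A) (py , y∈A) (pk , ¬sk , xk) (_ , _ , yk) (pk′ , ¬sk′ , xk′) →
            misses-intro pk′ ¬sk′ λ yk′ →
              clique-triangle pa pk pk′ py px (λ a≡k → ¬sk (inj₁ (sym a≡k)))
                yk′ (nonadjacent-a y∈A) yk (nonadjacent-a x∈A) xk xk′
        ; B-misses-petals = B-misses-A
        ; B-uniform = λ b∈B b′∈B (pk , ¬sk , bk) → misses-intro pk ¬sk λ b′k →
            clique-triangle pc pc′ pk (proj₁ b′∈B) (proj₁ b∈B) (λ c≡c′ → c′≢c (sym c≡c′))
              b′k (B-misses-c b′∈B) (B-misses-c′ b′∈B) (B-misses-c b∈B) (B-misses-c′ b∈B) bk
        }

    discord⇒cw : CWAtMost 13 G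
    discord⇒cw with straggler?
    ... | yes (y₀ , c′ , straggler) = straggler⇒cw y₀ c′ straggler
    ... | no none = no-straggler⇒cw none

  split-cw : V → CWAtMost 13 G
  split-cw z with discord?
  ... | yes (d , v , a , c , pd , pv , pa , pc , da , va , dc , vc) = WithDiscord.discord⇒cw d v a c pd pv pa pc da va dc vc
  ... | no none = no-discord⇒cw z none

split-paw-free⇒cw : ∀ G → IsSplit G → Free P₁+paw G → CWAtMost 13 G
split-paw-free⇒cw record { n = zero } _ _ = empty , ⤖-id (Fin 0) , λ ()
split-paw-free⇒cw G@(record { n = suc _ }) (part , clique , indep) free = SplitPawFree.split-cw G part clique indep free zero

lemma22 : BoundedCW (λ G → IsSplit G × Free P₁+paw G)
lemma22 = 13 , λ G (split , free) → split-paw-free⇒cw G split free
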